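{- Let $P\in\mathcal P(w_0^{(n+1)})$ and let $I,J$ be ideals (down-closed subsets) of $P$ such that $|\{x\in I: f_P(x)=i\}|=|\{x\in J: f_P(x)=i\}|$ for all $1\le i\le n$. Then $I=J$.
   Context: Let $w_0^{(n+1)}$ be the longest element of the symmetric group $\mathfrak S_{n+1}$ (simple transpositions $s_i=(i,i+1)$); $\mathscr R(w)$ is the set of reduced words of $w$. A word poset is a finite poset $P$ with $f_P:P\to\mathbb{Z}_{>0}$; $P\sim Q$ if there is a poset isomorphism $\phi$ with $f_Q\circ\phi=f_P$. For $\mathbf i=(i_1,\dots,i_\ell)\in\mathscr R(w)$, $P_{\mathbf i}$ is the poset on $[\ell]$ generated (reflexive transitive closure) by $j<k$ for $j<k$ with $|i_j-i_k|=1$, with $f_{P_{\mathbf i}}(j)=i_j$; $\mathcal P(w)$ is the set of word posets isomorphic to some $P_{\mathbf i}$, $\mathbf i\in\mathscr R(w)$. -}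

module Defs where

open import Data.Nat using (ℕ; zero; suc; _+_; _<_; _≤_; _≡ᵇ_; _<ᵇ_)
open import Data.Bool using (Bool; true; false; _∧_; if_then_else_)
open import Data.Fin using (Fin; toℕ)
open import Data.List using (List; []; _∷_; length; map; upTo; reverse; allFin; lookup; foldl)
open import Data.Nat.ListAction using (sum)
open import Data.List.Relation.Unary.All using (All)
open import Data.Product using (Σ; _×_; ∃)
open import Data.Sum using (_⊎_)
open import Function.Bundles using (_↔_; Inverse)
open import Relation.Binary.PropositionalEquality using (_≡_)
open import Relation.Binary.Structures using (IsPartialOrder)
open import Relation.Binary.Construct.Closure.ReflexiveTransitive using (Star)

-- Permutations of S_m in one-line notation (a list w(1) … w(m)).

idPerm : ℕ → List ℕ
idPerm m = map suc (upTo m)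

w₀ : ℕ → List ℕ
w₀ m = reverse (idPerm m)

-- right multiplication by s_i = (i,i+1): swaps positions i and i+1
-- of the one-line notation (i is 1-indexed).
swapPos : ℕ → List ℕ → List ℕ
swapPos (suc zero) (a ∷ b ∷ l) = b ∷ a ∷ l
swapPos (suc (suc k)) (a ∷ l) = a ∷ swapPos (suc k) l
swapPos _ l = l

wordProduct : ℕ → List ℕ → List ℕ
wordProduct m w = foldl (λ p i → swapPos i p) (idPerm m) w

-- Coxeter length of a permutation = number of inversions
inversions : List ℕ → ℕ
inversions [] = 0
inversions (a ∷ l) = sum (map (λ b → if b <ᵇ a then 1 else 0) l) + inversions l

IsReducedWord : (m : ℕ) → List ℕ → List ℕ → Set
IsReducedWord m w i =
  All (λ a → 1 ≤ a × suc a ≤ m) i × wordProduct m i ≡ w × length i ≡ inversions w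

record WordPoset : Set₁ where
  field
    size   : ℕ
    _≼_    : Fin size → Fin size → Set
    isPO   : IsPartialOrder _≡_ _≼_
    label  : Fin size → ℕ
    label-pos : ∀ x → 0 < label x

data Gen (i : List ℕ) : Fin (length i) → Fin (length i) → Set where
  gen : ∀ {j k} → toℕ j < toℕ k →
        (suc (lookup i j) ≡ lookup i k) ⊎ (suc (lookup i k) ≡ lookup i j) →
        Gen i j k

OrdP : (i : List ℕ) → Fin (length i) → Fin (length i) → Set
OrdP i = Star (Gen i)

IsoToWordPoset : WordPoset → List ℕ → Set
IsoToWordPoset P i =
  Σ (Fin size ↔ Fin (length i)) λ φ →
    (∀ x y → (x ≼ y → OrdP i (Inverse.to φ x) (Inverse.to φ y))
           × (OrdP i (Inverse.to φ x) (Inverse.to φ y) → x ≼ y))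
    × (∀ x → lookup i (Inverse.to φ x) ≡ label x)
  where open WordPoset P

InWordPosets : (m : ℕ) → List ℕ → WordPoset → Set
InWordPosets m w P = Σ (List ℕ) λ i → IsReducedWord m w i × IsoToWordPoset P i

record Ideal (P : WordPoset) : Set where
  open WordPoset P
  field
    mem  : Fin size → Bool
    down : ∀ {x y} → y ≼ x → mem x ≡ true → mem y ≡ true

countLabel : (P : WordPoset) → Ideal P → ℕ → ℕ
countLabel P I a =
  sum (map (λ x → if Ideal.mem I x ∧ (WordPoset.label P x ≡ᵇ a) then 1 else 0)
           (allFin (WordPoset.size P)))

-- In a reduced word, two occurrences of a letter a are separated by an occurrence of a - 1 or
-- a + 1: otherwise the second s_a commutes past the letters in between and cancels the first,
-- giving a shorter word for the same permutation. Hence the elements of P with a given label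
-- form a chain, and an ideal meets this chain in an initial segment determined by its size.
module Submission where

open import Defs
open import Data.Nat using (ℕ; zero; suc; _+_; _≤_; _<_; z≤n; s≤s; z<s; _<ᵇ_; _≡ᵇ_)
open import Data.Nat.Properties
open import Data.Nat.ListAction using (sum)
open import Data.Nat.ListAction.Properties using (sum-↭)
open import Data.Bool using (Bool; true; false; _∧_; if_then_else_)
open import Data.Bool.Properties using (T-≡)
open import Data.Fin using (Fin; toℕ) renaming (zero to fzero; suc to fsuc)
open import Data.Fin.Properties using (any?; toℕ-injective)
open import Data.List using (List; []; _∷_; length; map; foldl; lookup)
open import Data.List.Membership.Propositional using (_∈_)
open import Data.List.Membership.Propositional.Properties using (∈-allFin; ∈-lookup)
open import Data.List.Relation.Unary.Any using (here; there)
open import Data.List.Relation.Unary.All using (All; []; _∷_)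
import Data.List.Relation.Unary.All as All
open import Data.List.Relation.Unary.AllPairs using (AllPairs; []; _∷_)
import Data.List.Relation.Unary.AllPairs.Properties as AllPairs
open import Data.List.Relation.Binary.Permutation.Propositional using (_↭_; ↭-refl; prep; swap)
import Data.List.Relation.Binary.Permutation.Propositional.Properties as ↭
open import Data.Product using (∃; _×_; _,_; proj₁; proj₂)
open import Data.Sum using (_⊎_; inj₁; inj₂)
import Data.Sum as Sum
open import Data.Empty using (⊥-elim)
open import Relation.Nullary using (¬_; Dec; yes; no; _×-dec_; _⊎-dec_)
open import Relation.Binary using (tri<; tri≈; tri>)
open import Relation.Binary.PropositionalEquality
open import Relation.Binary.Construct.Closure.ReflexiveTransitive using (ε; _◅_; _◅◅_)
open import Function.Bundles using (Inverse; Equivalence)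
open import Algebra.Properties.CommutativeSemigroup +-commutativeSemigroup using (x∙yz≈y∙xz)

applyWord : List ℕ → List ℕ → List ℕ
applyWord = foldl (λ p i → swapPos i p)

isInversion : ℕ → ℕ → ℕ
isInversion a b = if b <ᵇ a then 1 else 0

countBelow : ℕ → List ℕ → ℕ
countBelow a l = sum (map (isInversion a) l)

isInversion≤1 : ∀ a b → isInversion a b ≤ 1
isInversion≤1 a b with b <ᵇ a
... | true  = ≤-refl
... | false = z≤n

countBelow-≡0 : ∀ {a l} → All (a ≤_) l → countBelow a l ≡ 0
countBelow-≡0 [] = refl
countBelow-≡0 {a} {b ∷ l} (a≤b ∷ a≤l) with b <ᵇ a in b<a
... | true  = ⊥-elim (<⇒≱ (<ᵇ⇒< b a (Equivalence.from T-≡ b<a)) a≤b)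
... | false = countBelow-≡0 a≤l

inversions-ascending : ∀ {l} → AllPairs _≤_ l → inversions l ≡ 0
inversions-ascending []          = refl
inversions-ascending (a≤l ∷ asc) = cong₂ _+_ (countBelow-≡0 a≤l) (inversions-ascending asc)

inversions-idPerm : ∀ m → inversions (idPerm m) ≡ 0
inversions-idPerm m = inversions-ascending
  (AllPairs.map⁺ (AllPairs.applyUpTo⁺₁ (λ x → x) m (λ i<j _ → s≤s (<⇒≤ i<j))))

Adjacent : ℕ → ℕ → Set
Adjacent a b = suc a ≡ b ⊎ suc b ≡ a

adjacent? : ∀ a b → Dec (Adjacent a b)
adjacent? a b = (suc a ≟ b) ⊎-dec (suc b ≟ a)

Distant : ℕ → ℕ → Set
Distant a b = a ≢ b × ¬ Adjacent a b

swapPos-involutive : ∀ k l → swapPos k (swapPos k l) ≡ l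
swapPos-involutive zero          l           = refl
swapPos-involutive (suc zero)    []          = refl
swapPos-involutive (suc zero)    (x ∷ [])    = refl
swapPos-involutive (suc zero)    (x ∷ y ∷ l) = refl
swapPos-involutive (suc (suc k)) []          = refl
swapPos-involutive (suc (suc k)) (x ∷ l)     = cong (x ∷_) (swapPos-involutive (suc k) l)

swapPos-comm : ∀ a b l → Distant a b → swapPos a (swapPos b l) ≡ swapPos b (swapPos a l)
swapPos-comm zero                b                   l           _            = refl
swapPos-comm (suc a)             zero                l           _            = refl
swapPos-comm (suc zero)          (suc zero)          l           (a≢b , _)    = ⊥-elim (a≢b refl)
swapPos-comm (suc zero)          (suc (suc zero))    l           (_ , ¬adj)   = ⊥-elim (¬adj (inj₁ refl))
swapPos-comm (suc zero)          (suc (suc (suc b))) []          _            = refl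
swapPos-comm (suc zero)          (suc (suc (suc b))) (x ∷ [])    _            = refl
swapPos-comm (suc zero)          (suc (suc (suc b))) (x ∷ y ∷ l) _            = refl
swapPos-comm (suc (suc zero))    (suc zero)          l           (_ , ¬adj)   = ⊥-elim (¬adj (inj₂ refl))
swapPos-comm (suc (suc (suc a))) (suc zero)          []          _            = refl
swapPos-comm (suc (suc (suc a))) (suc zero)          (x ∷ [])    _            = refl
swapPos-comm (suc (suc (suc a))) (suc zero)          (x ∷ y ∷ l) _            = refl
swapPos-comm (suc (suc a))       (suc (suc b))       []          _            = refl
swapPos-comm (suc (suc a))       (suc (suc b))       (x ∷ l)     (a≢b , ¬adj) =
  cong (x ∷_) (swapPos-comm (suc a) (suc b) l
    ((λ e → a≢b (cong suc e)) , (λ adj → ¬adj (Sum.map (cong suc) (cong suc) adj))))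

swapPos-↭ : ∀ k l → swapPos k l ↭ l
swapPos-↭ zero          l           = ↭-refl
swapPos-↭ (suc zero)    []          = ↭-refl
swapPos-↭ (suc zero)    (x ∷ [])    = ↭-refl
swapPos-↭ (suc zero)    (x ∷ y ∷ l) = swap y x ↭-refl
swapPos-↭ (suc (suc k)) []          = ↭-refl
swapPos-↭ (suc (suc k)) (x ∷ l)     = prep x (swapPos-↭ (suc k) l)

countBelow-swapPos : ∀ a k l → countBelow a (swapPos k l) ≡ countBelow a l
countBelow-swapPos a k l = sum-↭ (↭.map⁺ (isInversion a) (swapPos-↭ k l))

inversions-swapPos : ∀ k l → inversions (swapPos k l) ≤ suc (inversions l)
inversions-swapPos zero          l           = n≤1+n _
inversions-swapPos (suc zero)    []          = n≤1+n _
inversions-swapPos (suc zero)    (x ∷ [])    = n≤1+n _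
inversions-swapPos (suc zero)    (x ∷ y ∷ l) = begin
  (isInversion y x + countBelow y l) + (countBelow x l + inversions l)
    ≤⟨ +-monoˡ-≤ _ (+-monoˡ-≤ _ (isInversion≤1 y x)) ⟩
  suc (countBelow y l + (countBelow x l + inversions l))
    ≡⟨ cong suc (x∙yz≈y∙xz (countBelow y l) (countBelow x l) (inversions l)) ⟩
  suc (countBelow x l + (countBelow y l + inversions l))
    ≤⟨ s≤s (+-monoˡ-≤ _ (m≤n+m _ (isInversion x y))) ⟩
  suc ((isInversion x y + countBelow x l) + (countBelow y l + inversions l)) ∎
  where open ≤-Reasoning
inversions-swapPos (suc (suc k)) []          = n≤1+n _
inversions-swapPos (suc (suc k)) (x ∷ l)     = begin
  countBelow x (swapPos (suc k) l) + inversions (swapPos (suc k) l)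
    ≡⟨ cong (_+ _) (countBelow-swapPos x (suc k) l) ⟩
  countBelow x l + inversions (swapPos (suc k) l)
    ≤⟨ +-monoʳ-≤ _ (inversions-swapPos (suc k) l) ⟩
  countBelow x l + suc (inversions l)
    ≡⟨ +-suc _ _ ⟩
  suc (countBelow x l + inversions l) ∎
  where open ≤-Reasoning

inversions-applyWord : ∀ q w → inversions (applyWord q w) ≤ inversions q + length w
inversions-applyWord q []      = ≤-reflexive (sym (+-identityʳ _))
inversions-applyWord q (a ∷ w) = begin
  inversions (applyWord (swapPos a q) w) ≤⟨ inversions-applyWord (swapPos a q) w ⟩
  inversions (swapPos a q) + length w    ≤⟨ +-monoˡ-≤ _ (inversions-swapPos a q) ⟩
  suc (inversions q) + length w          ≡⟨ +-suc _ _ ⟨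
  inversions q + suc (length w)          ∎
  where open ≤-Reasoning

CancellablePair : (w : List ℕ) → Fin (length w) → Fin (length w) → Set
CancellablePair w j k =
  toℕ j < toℕ k × lookup w j ≡ lookup w k ×
  (∀ m → toℕ j < toℕ m → toℕ m < toℕ k → Distant (lookup w j) (lookup w m))

applyWord-swapPos-cancel : ∀ a w (k : Fin (length w)) → lookup w k ≡ a →
  (∀ m → toℕ m < toℕ k → Distant a (lookup w m)) →
  ∀ q → ∃ λ r → suc (length r) ≡ length w × applyWord (swapPos a q) w ≡ applyWord q r
applyWord-swapPos-cancel a (b ∷ w) fzero    b≡a _ q =
  w , refl , cong (λ p → applyWord p w)
    (trans (cong (λ c → swapPos c (swapPos a q)) b≡a) (swapPos-involutive a q))
applyWord-swapPos-cancel a (b ∷ w) (fsuc k) wk≡a distant q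
  with applyWord-swapPos-cancel a w k wk≡a (λ m m<k → distant (fsuc m) (s≤s m<k)) (swapPos b q)
... | r , len , eq =
  b ∷ r , cong suc len ,
  trans (cong (λ p → applyWord p w) (sym (swapPos-comm a b q (distant fzero z<s)))) eq

applyWord-cancelPair : ∀ w (j k : Fin (length w)) → CancellablePair w j k →
  ∀ q → ∃ λ r → 2 + length r ≡ length w × applyWord q w ≡ applyWord q r
applyWord-cancelPair (b ∷ w) fzero (fsuc k) (_ , b≡wk , distant) q
  with applyWord-swapPos-cancel b w k (sym b≡wk) (λ m m<k → distant (fsuc m) z<s (s≤s m<k)) q
... | r , len , eq = r , cong suc len , eq
applyWord-cancelPair (b ∷ w) (fsuc j) (fsuc k) (s≤s j<k , wj≡wk , distant) q
  with applyWord-cancelPair w j k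
         (j<k , wj≡wk , λ m j<m m<k → distant (fsuc m) (s≤s j<m) (s≤s m<k)) (swapPos b q)
... | r , len , eq = b ∷ r , cong suc len , eq

reducedWord-minimal : ∀ {m v w} → IsReducedWord m v w →
  ∀ r → applyWord (idPerm m) r ≡ v → length w ≤ length r
reducedWord-minimal {m} {v} {w} (_ , _ , length≡ℓ) r product≡v = begin
  length w                             ≡⟨ length≡ℓ ⟩
  inversions v                         ≡⟨ cong inversions product≡v ⟨
  inversions (applyWord (idPerm m) r)  ≤⟨ inversions-applyWord (idPerm m) r ⟩
  inversions (idPerm m) + length r     ≡⟨ cong (_+ length r) (inversions-idPerm m) ⟩
  length r                             ∎
  where open ≤-Reasoning

reducedWord⇒¬cancellablePair : ∀ {m v w} → IsReducedWord m v w →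
  ∀ j k → ¬ CancellablePair w j k
reducedWord⇒¬cancellablePair {m} {w = w} reduced@(_ , product≡v , _) j k cancellable
  with applyWord-cancelPair w j k cancellable (idPerm m)
... | r , len , eq = 1+n≰n (≤-trans (m≤n+m _ 1)
        (≤-trans (≤-reflexive len) (reducedWord-minimal reduced r (trans (sym eq) product≡v))))

module _ (w : List ℕ) (noCancellablePair : ∀ j k → ¬ CancellablePair w j k) where

  private
    Between : Fin (length w) → Fin (length w) → Fin (length w) → Set
    Between j k m = toℕ j < toℕ m × toℕ m < toℕ k

    between? : ∀ j k m → Dec (Between j k m)
    between? j k m = (toℕ j <? toℕ m) ×-dec (toℕ m <? toℕ k)

  -- Recursion on the fuel d ≥ k - j: an adjacent letter in between links j and k in two
  -- steps, an equal letter in between splits the gap, and neither would give a cancellable pair.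
  sameLetter-ordered : ∀ d (j k : Fin (length w)) → toℕ k ≤ toℕ j + d →
    toℕ j < toℕ k → lookup w j ≡ lookup w k → OrdP w j k
  sameLetter-ordered zero j k k≤j+0 j<k _ = ⊥-elim (<⇒≱ j<k (subst (toℕ k ≤_) (+-identityʳ _) k≤j+0))
  sameLetter-ordered (suc d) j k k≤j+d j<k wj≡wk
    with any? (λ m → between? j k m ×-dec adjacent? (lookup w j) (lookup w m))
  ... | yes (m , (j<m , m<k) , adj) =
    gen j<m adj ◅ gen m<k (subst (Adjacent (lookup w m)) wj≡wk (Sum.swap adj)) ◅ ε
  ... | no noAdjacent with any? (λ m → between? j k m ×-dec (lookup w j ≟ lookup w m))
  ...   | yes (m , (j<m , m<k) , wj≡wm) =
    sameLetter-ordered d j m (≤-pred (subst (toℕ m <_) (+-suc _ d) (<-≤-trans m<k k≤j+d))) j<m wj≡wm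
    ◅◅ sameLetter-ordered d m k (≤-trans k≤j+d (≤-trans (≤-reflexive (+-suc _ d)) (+-monoˡ-≤ d j<m)))
                               m<k (trans (sym wj≡wm) wj≡wk)
  ...   | no noEqual = ⊥-elim (noCancellablePair j k (j<k , wj≡wk ,
    λ m j<m m<k → (λ e → noEqual (m , (j<m , m<k) , e)) , (λ adj → noAdjacent (m , (j<m , m<k) , adj))))

  sameLetter-comparable : ∀ j k → lookup w j ≡ lookup w k → OrdP w j k ⊎ OrdP w k j
  sameLetter-comparable j k wj≡wk with <-cmp (toℕ j) (toℕ k)
  ... | tri< j<k _ _ = inj₁ (sameLetter-ordered (toℕ k) j k (m≤n+m _ _) j<k wj≡wk)
  ... | tri≈ _ j≡k _ = inj₁ (subst (OrdP w j) (toℕ-injective j≡k) ε)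
  ... | tri> _ _ k<j = inj₂ (sameLetter-ordered (toℕ j) k j (m≤n+m _ _) k<j (sym wj≡wk))

SameLabelComparable : WordPoset → Set
SameLabelComparable P = ∀ x y → label x ≡ label y → x ≼ y ⊎ y ≼ x
  where open WordPoset P

sameLabel-comparable : ∀ P {m v w} → IsReducedWord m v w → IsoToWordPoset P w →
  SameLabelComparable P
sameLabel-comparable P {w = w} reduced (φ , order , label≡) x y lx≡ly =
  Sum.map (proj₂ (order x y)) (proj₂ (order y x))
    (sameLetter-comparable w (reducedWord⇒¬cancellablePair reduced) (to x) (to y)
      (trans (label≡ x) (trans lx≡ly (sym (label≡ y)))))
  where open Inverse φ

sum-map-mono-≤ : ∀ {A : Set} {f g : A → ℕ} → (∀ y → f y ≤ g y) →
  ∀ xs → sum (map f xs) ≤ sum (map g xs)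
sum-map-mono-≤ f≤g []       = z≤n
sum-map-mono-≤ f≤g (y ∷ xs) = +-mono-≤ (f≤g y) (sum-map-mono-≤ f≤g xs)

sum-map-mono-< : ∀ {A : Set} {f g : A → ℕ} → (∀ y → f y ≤ g y) →
  ∀ {x xs} → x ∈ xs → f x < g x → sum (map f xs) < sum (map g xs)
sum-map-mono-< f≤g {xs = y ∷ xs} (here refl) fx<gx = +-mono-<-≤ fx<gx (sum-map-mono-≤ f≤g xs)
sum-map-mono-< f≤g {xs = y ∷ xs} (there x∈xs) fx<gx = +-mono-≤-< (f≤g y) (sum-map-mono-< f≤g x∈xs fx<gx)

indicator-mono : ∀ {b b′ c : Bool} → (b ≡ true → c ≡ true → b′ ≡ true) →
  (if b ∧ c then 1 else 0) ≤ (if b′ ∧ c then 1 else 0)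
indicator-mono {false}                 _ = z≤n
indicator-mono {true} {_}    {false}   _ = z≤n
indicator-mono {true} {b′}   {true}    b⇒b′ rewrite b⇒b′ refl refl = ≤-refl

module _ (P : WordPoset) (comparable : SameLabelComparable P) where
  open WordPoset P

  countLabel-< : ∀ (I J : Ideal P) x → Ideal.mem I x ≡ true → Ideal.mem J x ≡ false →
    countLabel P J (label x) < countLabel P I (label x)
  countLabel-< I J x x∈I x∉J =
    sum-map-mono-< (λ y → indicator-mono (J⊆I y)) (∈-allFin x) x-counted
    where
    J⊆I : ∀ y → Ideal.mem J y ≡ true → (label y ≡ᵇ label x) ≡ true → Ideal.mem I y ≡ true
    J⊆I y y∈J ly≡lx with comparable y x (≡ᵇ⇒≡ _ _ (Equivalence.from T-≡ ly≡lx))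
    ... | inj₁ y≼x = Ideal.down I y≼x x∈I
    ... | inj₂ x≼y with trans (sym (Ideal.down J x≼y y∈J)) x∉J
    ...   | ()
    x-counted : (if Ideal.mem J x ∧ (label x ≡ᵇ label x) then 1 else 0)
              < (if Ideal.mem I x ∧ (label x ≡ᵇ label x) then 1 else 0)
    x-counted rewrite x∈I | x∉J | Equivalence.to T-≡ (≡⇒≡ᵇ (label x) (label x) refl) = s≤s z≤n

  ideal-mem-determined : ∀ (I J : Ideal P) x → countLabel P I (label x) ≡ countLabel P J (label x) →
    Ideal.mem I x ≡ Ideal.mem J x
  ideal-mem-determined I J x counts with Ideal.mem I x in x∈I | Ideal.mem J x in x∈J
  ... | true  | true  = refl
  ... | false | false = refl
  ... | true  | false = ⊥-elim (<⇒≢ (countLabel-< I J x x∈I x∈J) (sym counts))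
  ... | false | true  = ⊥-elim (<⇒≢ (countLabel-< J I x x∈J x∈I) counts)

lemma5p3 : (n : ℕ) (P : WordPoset) → InWordPosets (suc n) (w₀ (suc n)) P →
    (I J : Ideal P) →
    (∀ i → 1 ≤ i → i ≤ n → countLabel P I i ≡ countLabel P J i) →
    ∀ (x : Fin (WordPoset.size P)) → Ideal.mem I x ≡ Ideal.mem J x
lemma5p3 n P (w , reduced@(letters , _) , iso@(φ , _ , label≡)) I J counts x =
  ideal-mem-determined P (sameLabel-comparable P reduced iso) I J x
    (counts (label x) (proj₁ letter-range) (≤-pred (proj₂ letter-range)))
  where
  open WordPoset P
  letter-range : 1 ≤ label x × suc (label x) ≤ suc n
  letter-range = subst (λ a → 1 ≤ a × suc a ≤ suc n) (label≡ x)
    (All.lookup letters (∈-lookup (Inverse.to φ x)))
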